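{- Let $V=\{1,\dots,n\}$, let $f:2^V\to\mathbb{R}$ be submodular with $f(\emptyset)=0$, and let $\mathcal P^f_{\mathrm{gen}}=\{(x,c)\in\mathbb{R}^n\times\mathbb{R}: x(X)+c\ge f(X)\ \forall X\subseteq V\}$. A point $(x,c)$ is an extreme point of $\mathcal P^f_{\mathrm{gen}}$ if and only if there is a set $X\subseteq V$ such that $x$ is an extreme point of $\partial^f(X)=\{z\in\mathbb{R}^n: f(Y)-z(Y)\le f(X)-z(X)\ \forall Y\subseteq V\}$ and $c=f(X)-x(X)$.
   Context: For $x\in\mathbb{R}^n$ and $S\subseteq V$, $x(S)=\sum_{i\in S}x_i$. $f$ is submodular if $f(S)+f(T)\ge f(S\cup T)+f(S\cap T)$ for all $S,T\subseteq V$. -}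

module Defs where

open import Level using (Level; _⊔_) renaming (suc to lsuc)
open import Data.Nat using (ℕ; zero; suc)
open import Data.Fin using (Fin; zero; suc)
open import Data.Bool using (Bool; true; false; if_then_else_)
open import Data.Vec using (Vec; []; _∷_)
open import Data.Fin.Subset using (Subset; _∪_; _∩_) renaming (⊥ to ∅)
open import Data.Product using (Σ; _×_; _,_; ∃)
open import Relation.Nullary using (¬_)
open import Relation.Binary.PropositionalEquality using (_≡_)
open import Algebra.Structures using (IsCommutativeRing)
open import Relation.Binary.Structures using (IsTotalOrder)

-- An ordered field (with propositional equality as the equality).
-- The reals are one; the theorem is stated for an arbitrary ordered field.
record OrderedField (c ℓ : Level) : Set (lsuc (c ⊔ ℓ)) where
  infixl 6 _+_
  infixl 7 _*_
  infix 4 _≤_ _<_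
  field
    Carrier : Set c
    _+_ _*_ : Carrier → Carrier → Carrier
    -_ : Carrier → Carrier
    0# 1# : Carrier
    _≤_ : Carrier → Carrier → Set ℓ
    isCommutativeRing : IsCommutativeRing _≡_ _+_ _*_ -_ 0# 1#
    isTotalOrder : IsTotalOrder _≡_ _≤_
    0≢1 : ¬ (0# ≡ 1#)
    inverse : ∀ x → ¬ (x ≡ 0#) → Σ Carrier (λ y → x * y ≡ 1#)
    +-mono-≤ : ∀ {x y} z → x ≤ y → x + z ≤ y + z
    *-nonneg : ∀ {x y} → 0# ≤ x → 0# ≤ y → 0# ≤ x * y

  _-_ : Carrier → Carrier → Carrier
  x - y = x + (- y)

  _<_ : Carrier → Carrier → Set (c ⊔ ℓ)
  x < y = (x ≤ y) × ¬ (x ≡ y)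

module Submod {c ℓ} (F : OrderedField c ℓ) where
  open OrderedField F

  sumSet : ∀ {n} → (Fin n → Carrier) → Subset n → Carrier
  sumSet {zero} x [] = 0#
  sumSet {suc n} x (b ∷ S) = (if b then x zero else 0#) + sumSet (λ i → x (suc i)) S

  Submodular : ∀ {n} → (Subset n → Carrier) → Set ℓ
  Submodular f = ∀ S T → f (S ∪ T) + f (S ∩ T) ≤ f S + f T

  InPgen : ∀ {n} → (Subset n → Carrier) → (Fin n → Carrier) → Carrier → Set ℓ
  InPgen f x c = ∀ X → f X ≤ sumSet x X + c

  InSubdiff : ∀ {n} → (Subset n → Carrier) → Subset n → (Fin n → Carrier) → Set ℓ
  InSubdiff f X z = ∀ Y → f Y - sumSet z Y ≤ f X - sumSet z X

  cc : Carrier → Carrier → Carrier → Carrier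
  cc t a b = t * a + (1# - t) * b

  IsExtreme : ∀ {n} → ((Fin n → Carrier) → Set ℓ) → (Fin n → Carrier) → Set (c ⊔ ℓ)
  IsExtreme P z = P z × (∀ y w t → 0# < t → t < 1# → P y → P w →
                         (∀ i → z i ≡ cc t (y i) (w i)) → ∀ i → y i ≡ w i)

  IsExtremePair : ∀ {n} → ((Fin n → Carrier) → Carrier → Set ℓ) →
                  (Fin n → Carrier) → Carrier → Set (c ⊔ ℓ)
  IsExtremePair P x e = P x e × (∀ y d w d' t → 0# < t → t < 1# → P y d → P w d' →
                         (∀ i → x i ≡ cc t (y i) (w i)) → e ≡ cc t d d' →
                         (∀ i → y i ≡ w i) × d ≡ d')

module Submission where

-- Write  excess x X = f(X) − x(X).  Then (x , c) ∈ P_gen iff c bounds every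
-- excess, and z ∈ ∂^f(X) iff X maximises  excess z.  Everything rests on the
-- fact that  excess  is affine in x, so convex combinations commute with it.
--
--  (⇒) If (x , e) is extreme and X maximises  excess x  (a finite maximum),
--      then e = excess x X: otherwise (x , e) is the midpoint of the two
--      distinct points (x , excess x X) and (x , 2e − excess x X) of P_gen.
--      A splitting x = t y + (1−t) w inside ∂^f(X) lifts to the splitting
--      (x , e) = t (y , excess y X) + (1−t) (w , excess w X) inside P_gen.
--  (⇐) If (x , e) = t (y , d) + (1−t) (w , d') in P_gen and e = excess x X,
--      then the nonnegative slacks d − excess y X, d' − excess w X have a zero
--      convex combination, so both vanish; hence y, w ∈ ∂^f(X) and y = w.

open import Defs
open import Data.Nat using (ℕ; zero; suc)
open import Data.Fin using (Fin; zero; suc)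
open import Data.Fin.Subset using (Subset) renaming (⊥ to ∅)
open import Data.Bool using (true; false; if_then_else_)
open import Data.Vec using ([]; _∷_)
open import Data.Sum using (inj₁; inj₂)
open import Data.Product using (Σ; _×_; _,_; proj₁; proj₂)
open import Data.Empty using (⊥-elim)
open import Data.Maybe using (nothing)
open import Relation.Nullary using (¬_)
open import Relation.Binary.PropositionalEquality
  using (_≡_; refl; sym; trans; cong; cong₂; subst; subst₂; module ≡-Reasoning)
open import Relation.Binary.Structures using (IsTotalOrder)
open import Algebra.Bundles using (CommutativeRing)
open import Algebra.Solver.Ring.AlmostCommutativeRing
  using (AlmostCommutativeRing; fromCommutativeRing; -raw-almostCommutative⟶)
open import Function.Bundles using (_⇔_; mk⇔)

module FieldFacts {c ℓ} (F : OrderedField c ℓ) where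
  open OrderedField F
  open Submod F using (cc)
  open IsTotalOrder isTotalOrder public
    using (total; antisym) renaming (refl to ≤-refl; trans to ≤-trans)

  commutativeRing : CommutativeRing c c
  commutativeRing = record { isCommutativeRing = isCommutativeRing }

  open CommutativeRing commutativeRing
    using (ring; +-comm; +-assoc; *-comm; *-assoc; -‿inverseʳ; -‿inverseˡ;
           *-identityˡ; +-identityˡ; +-identityʳ; zeroʳ; distribˡ; distribʳ)
  open import Algebra.Properties.Ring ring
    using (-‿involutive; -‿+-comm; -‿distribʳ-*; x∙y⁻¹≈ε⇒x≈y)

  private
    almostCommutativeRing : AlmostCommutativeRing c c
    almostCommutativeRing = fromCommutativeRing commutativeRing

  -- Normalisation of commutative-semiring identities.  Coefficients are not
  -- compared, so negated terms enter only as atoms and every cancellation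
  -- x − x = 0 is done explicitly (by x+[y-y]≡x).
  open import Algebra.Solver.Ring (AlmostCommutativeRing.rawRing almostCommutativeRing)
    almostCommutativeRing (-raw-almostCommutative⟶ almostCommutativeRing) (λ _ _ → nothing)

  open ≡-Reasoning

  x+[y-y]≡x : ∀ x y → x + (y - y) ≡ x
  x+[y-y]≡x x y = trans (cong (x +_) (-‿inverseʳ y)) (+-identityʳ x)

  -≡0⇒≡ : ∀ {a b} → a - b ≡ 0# → a ≡ b
  -≡0⇒≡ {a} {b} = x∙y⁻¹≈ε⇒x≈y a b

  ≤-resp-≡ : ∀ {a a' b b'} → a ≡ a' → b ≡ b' → a ≤ b → a' ≤ b'
  ≤-resp-≡ = subst₂ _≤_

  +-monoʳ-≤ : ∀ {a b} z → a ≤ b → z + a ≤ z + b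
  +-monoʳ-≤ {a} {b} z p = ≤-resp-≡ (+-comm a z) (+-comm b z) (+-mono-≤ z p)

  ≤+⇒-≤ : ∀ {a b d} → a ≤ b + d → a - b ≤ d
  ≤+⇒-≤ {a} {b} {d} p = ≤-resp-≡ refl [b+d]-b≡d (+-mono-≤ (- b) p)
    where
    [b+d]-b≡d : (b + d) - b ≡ d
    [b+d]-b≡d = trans (solve 3 (λ b d nb → (b :+ d) :+ nb := d :+ (b :+ nb)) refl b d (- b))
                      (x+[y-y]≡x d b)

  -≤⇒≤+ : ∀ {a b d} → a - b ≤ d → a ≤ b + d
  -≤⇒≤+ {a} {b} {d} p = ≤-resp-≡ [a-b]+b≡a (+-comm d b) (+-mono-≤ b p)
    where
    [a-b]+b≡a : (a - b) + b ≡ a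
    [a-b]+b≡a = trans (solve 3 (λ a b nb → (a :+ nb) :+ b := a :+ (b :+ nb)) refl a b (- b))
                      (x+[y-y]≡x a b)

  ≤⇒0≤- : ∀ {a b} → a ≤ b → 0# ≤ b - a
  ≤⇒0≤- {a} p = ≤-resp-≡ (-‿inverseʳ a) refl (+-mono-≤ (- a) p)

  ≤0⇒0≤- : ∀ {a} → a ≤ 0# → 0# ≤ - a
  ≤0⇒0≤- {a} p = ≤-resp-≡ (-‿inverseʳ a) (+-identityˡ (- a)) (+-mono-≤ (- a) p)

  0≰-1 : ¬ (0# ≤ - 1#)
  0≰-1 0≤-1 = 0≢1 (antisym 0≤1′ 1≤0)
    where
    1≤0 : 1# ≤ 0#
    1≤0 = ≤-resp-≡ (+-identityˡ 1#) (-‿inverseˡ 1#) (+-mono-≤ 1# 0≤-1)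
    [-1][-1]≡1 : (- 1#) * (- 1#) ≡ 1#
    [-1][-1]≡1 = begin
      (- 1#) * (- 1#)   ≡⟨ sym (-‿distribʳ-* (- 1#) 1#) ⟩
      - ((- 1#) * 1#)   ≡⟨ cong -_ (trans (*-comm (- 1#) 1#) (*-identityˡ (- 1#))) ⟩
      - (- 1#)          ≡⟨ -‿involutive 1# ⟩
      1#                ∎
    0≤1′ : 0# ≤ 1#
    0≤1′ = ≤-resp-≡ refl [-1][-1]≡1 (*-nonneg 0≤-1 0≤-1)

  0≤1 : 0# ≤ 1#
  0≤1 with total 0# 1#
  ... | inj₁ p = p
  ... | inj₂ p = ⊥-elim (0≰-1 (≤0⇒0≤- p))

  *-cancelˡ-0 : ∀ {t a} → ¬ (t ≡ 0#) → t * a ≡ 0# → a ≡ 0#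
  *-cancelˡ-0 {t} {a} t≢0 ta≡0 with inverse t t≢0
  ... | s , ts≡1 = begin
    a             ≡⟨ sym (*-identityˡ a) ⟩
    1# * a        ≡⟨ cong (_* a) (sym ts≡1) ⟩
    (t * s) * a   ≡⟨ trans (cong (_* a) (*-comm t s)) (*-assoc s t a) ⟩
    s * (t * a)   ≡⟨ cong (s *_) ta≡0 ⟩
    s * 0#        ≡⟨ zeroʳ s ⟩
    0#            ∎

  +-nonneg-0 : ∀ {a b} → 0# ≤ a → 0# ≤ b → a + b ≡ 0# → a ≡ 0#
  +-nonneg-0 {a} {b} 0≤a 0≤b a+b≡0 =
    antisym (≤-resp-≡ (+-identityˡ a) (trans (+-comm b a) a+b≡0) (+-mono-≤ a 0≤b)) 0≤a

  two : Carrier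
  two = 1# + 1#

  1≤two : 1# ≤ two
  1≤two = ≤-resp-≡ (+-identityˡ 1#) refl (+-mono-≤ 1# 0≤1)

  two≢0 : ¬ (two ≡ 0#)
  two≢0 two≡0 = 0≰-1 (≤0⇒0≤- (subst (1# ≤_) two≡0 1≤two))

  ½ : Carrier
  ½ = proj₁ (inverse two two≢0)

  two*½≡1 : two * ½ ≡ 1#
  two*½≡1 = proj₂ (inverse two two≢0)

  ½+½≡1 : ½ + ½ ≡ 1#
  ½+½≡1 = begin
    ½ + ½             ≡⟨ sym (cong₂ _+_ (*-identityˡ ½) (*-identityˡ ½)) ⟩
    1# * ½ + 1# * ½   ≡⟨ sym (distribʳ ½ 1# 1#) ⟩
    two * ½           ≡⟨ two*½≡1 ⟩
    1#                ∎

  1-½≡½ : 1# - ½ ≡ ½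
  1-½≡½ = trans (cong (_- ½) (sym ½+½≡1)) (trans (+-assoc ½ ½ (- ½)) (x+[y-y]≡x ½ ½))

  0<½ : 0# < ½
  0<½ = 0≤½ , λ 0≡½ → 0≢1 (trans (sym (+-identityʳ 0#)) (trans (cong₂ _+_ 0≡½ 0≡½) ½+½≡1))
    where
    -- ½ ≤ 0 would make  two * (− ½) = − 1  nonnegative.
    0≤½ : 0# ≤ ½
    0≤½ with total 0# ½
    ... | inj₁ p = p
    ... | inj₂ p = ⊥-elim (0≰-1 (≤-resp-≡ refl two*[-½]≡-1
                                  (*-nonneg (≤-trans 0≤1 1≤two) (≤0⇒0≤- p))))
      where
      two*[-½]≡-1 : two * (- ½) ≡ - 1#
      two*[-½]≡-1 = trans (sym (-‿distribʳ-* two ½)) (cong -_ two*½≡1)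

  ½<1 : ½ < 1#
  ½<1 = ≤-resp-≡ (+-identityˡ ½) ½+½≡1 (+-mono-≤ ½ (proj₁ 0<½))
      , λ ½≡1 → 0≢1 (trans (sym (-‿inverseʳ 1#)) (trans (cong (λ z → 1# - z) (sym ½≡1))
                                                        (trans 1-½≡½ ½≡1)))

  cc-const : ∀ t a → cc t a a ≡ a
  cc-const t a = begin
    t * a + (1# - t) * a   ≡⟨ sym (distribʳ a t (1# - t)) ⟩
    (t + (1# - t)) * a     ≡⟨ cong (_* a) t+[1-t]≡1 ⟩
    1# * a                 ≡⟨ *-identityˡ a ⟩
    a                      ∎
    where
    t+[1-t]≡1 : t + (1# - t) ≡ 1#
    t+[1-t]≡1 = trans (solve 3 (λ t o nt → t :+ (o :+ nt) := o :+ (t :+ nt)) refl t 1# (- t))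
                      (x+[y-y]≡x 1# t)

  cc-+ : ∀ t a b a' b' → cc t (a + a') (b + b') ≡ cc t a b + cc t a' b'
  cc-+ t a b a' b' = solve 6 (λ t u a b a' b' → t :* (a :+ a') :+ u :* (b :+ b')
                                                := (t :* a :+ u :* b) :+ (t :* a' :+ u :* b'))
                             refl t (1# - t) a b a' b'

  cc-neg : ∀ t a b → - cc t a b ≡ cc t (- a) (- b)
  cc-neg t a b = begin
    - (t * a + (1# - t) * b)          ≡⟨ sym (-‿+-comm (t * a) ((1# - t) * b)) ⟩
    - (t * a) + - ((1# - t) * b)      ≡⟨ cong₂ _+_ (-‿distribʳ-* t a) (-‿distribʳ-* (1# - t) b) ⟩
    t * (- a) + (1# - t) * (- b)      ∎

  cc-- : ∀ t a b a' b' → cc t a b - cc t a' b' ≡ cc t (a - a') (b - b')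
  cc-- t a b a' b' = trans (cong (cc t a b +_) (cc-neg t a' b')) (sym (cc-+ t a b (- a') (- b')))

  cc-nonneg-0 : ∀ {t a b} → 0# < t → t < 1# → 0# ≤ a → 0# ≤ b →
                cc t a b ≡ 0# → a ≡ 0# × b ≡ 0#
  cc-nonneg-0 {t} {a} {b} (0≤t , 0≢t) (t≤1 , t≢1) 0≤a 0≤b cc≡0 =
      *-cancelˡ-0 (λ t≡0 → 0≢t (sym t≡0)) (+-nonneg-0 0≤ta 0≤ub cc≡0)
    , *-cancelˡ-0 1-t≢0 (+-nonneg-0 0≤ub 0≤ta (trans (+-comm _ _) cc≡0))
    where
    0≤ta : 0# ≤ t * a
    0≤ta = *-nonneg 0≤t 0≤a
    0≤ub : 0# ≤ (1# - t) * b
    0≤ub = *-nonneg (≤⇒0≤- t≤1) 0≤b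
    1-t≢0 : ¬ (1# - t ≡ 0#)
    1-t≢0 1-t≡0 = t≢1 (sym (-≡0⇒≡ 1-t≡0))

  cc-midpoint : ∀ a e → cc ½ a (e + (e - a)) ≡ e
  cc-midpoint a e = begin
    ½ * a + (1# - ½) * (e + (e - a))   ≡⟨ cong (λ u → ½ * a + u * (e + (e - a))) 1-½≡½ ⟩
    ½ * a + ½ * (e + (e - a))          ≡⟨ sym (distribˡ ½ a (e + (e - a))) ⟩
    ½ * (a + (e + (e - a)))            ≡⟨ cong (½ *_) a+[2e-a]≡2e ⟩
    ½ * (e + e)                        ≡⟨ distribˡ ½ e e ⟩
    ½ * e + ½ * e                      ≡⟨ sym (distribʳ e ½ ½) ⟩
    (½ + ½) * e                        ≡⟨ cong (_* e) ½+½≡1 ⟩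
    1# * e                             ≡⟨ *-identityˡ e ⟩
    e                                  ∎
    where
    a+[2e-a]≡2e : a + (e + (e - a)) ≡ e + e
    a+[2e-a]≡2e = trans (solve 3 (λ a e na → a :+ (e :+ (e :+ na)) := (e :+ e) :+ (a :+ na)) refl a e (- a))
                        (x+[y-y]≡x (e + e) a)

module Excess {c ℓ} (F : OrderedField c ℓ) where
  open OrderedField F
  open Submod F
  open FieldFacts F
  open CommutativeRing commutativeRing using (+-identityʳ; -‿inverseʳ)
  open ≡-Reasoning

  sumSet-cong : ∀ {n} {y w : Fin n → Carrier} → (∀ i → y i ≡ w i) → ∀ S → sumSet y S ≡ sumSet w S
  sumSet-cong {zero} y≗w [] = refl
  sumSet-cong {suc n} y≗w (b ∷ S) =
    cong₂ _+_ (cong (λ z → if b then z else 0#) (y≗w zero)) (sumSet-cong (λ i → y≗w (suc i)) S)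

  sumSet-cc : ∀ {n} t {x y w : Fin n → Carrier} → (∀ i → x i ≡ cc t (y i) (w i)) →
              ∀ S → sumSet x S ≡ cc t (sumSet y S) (sumSet w S)
  sumSet-cc {zero} t x≡cc [] = sym (cc-const t 0#)
  sumSet-cc {suc n} t {x} {y} {w} x≡cc (b ∷ S) =
    trans (cong₂ _+_ (first b) (sumSet-cc t (λ i → x≡cc (suc i)) S)) (sym (cc-+ t _ _ _ _))
    where
    first : ∀ b → (if b then x zero else 0#) ≡ cc t (if b then y zero else 0#) (if b then w zero else 0#)
    first true  = x≡cc zero
    first false = sym (cc-const t 0#)

  excess : ∀ {n} → (Subset n → Carrier) → (Fin n → Carrier) → Subset n → Carrier
  excess f x X = f X - sumSet x X

  excess-cc : ∀ {n} {f : Subset n → Carrier} {t} {x y w : Fin n → Carrier} →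
              (∀ i → x i ≡ cc t (y i) (w i)) → ∀ X → excess f x X ≡ cc t (excess f y X) (excess f w X)
  excess-cc {f = f} {t} {x} {y} {w} x≡cc X = begin
    f X - sumSet x X                               ≡⟨ cong₂ _-_ (sym (cc-const t (f X))) (sumSet-cc t x≡cc X) ⟩
    cc t (f X) (f X) - cc t (sumSet y X) (sumSet w X) ≡⟨ cc-- t (f X) (f X) (sumSet y X) (sumSet w X) ⟩
    cc t (excess f y X) (excess f w X)              ∎

  maximiser : ∀ {n} (g : Subset n → Carrier) → Σ (Subset n) (λ X → ∀ Y → g Y ≤ g X)
  maximiser {zero} g = [] , λ { [] → ≤-refl }
  maximiser {suc n} g with maximiser (λ S → g (true ∷ S)) | maximiser (λ S → g (false ∷ S))
  ... | X₁ , max₁ | X₀ , max₀ with total (g (true ∷ X₁)) (g (false ∷ X₀))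
  ... | inj₁ ≤₀ = (false ∷ X₀) , λ { (true ∷ Y) → ≤-trans (max₁ Y) ≤₀ ; (false ∷ Y) → max₀ Y }
  ... | inj₂ ≤₁ = (true ∷ X₁)  , λ { (true ∷ Y) → max₁ Y ; (false ∷ Y) → ≤-trans (max₀ Y) ≤₁ }

  InPgen⇒excess≤ : ∀ {n} {f : Subset n → Carrier} {x c} → InPgen f x c → ∀ X → excess f x X ≤ c
  InPgen⇒excess≤ x∈P X = ≤+⇒-≤ (x∈P X)

  excess≤⇒InPgen : ∀ {n} {f : Subset n → Carrier} {x c} → (∀ X → excess f x X ≤ c) → InPgen f x c
  excess≤⇒InPgen bound X = -≤⇒≤+ (bound X)

  InSubdiff⇒InPgen : ∀ {n} {f : Subset n → Carrier} {X z} → InSubdiff f X z → InPgen f z (excess f z X)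
  InSubdiff⇒InPgen = excess≤⇒InPgen

  InPgen⇒InSubdiff : ∀ {n} {f : Subset n → Carrier} {X z} → InPgen f z (excess f z X) → InSubdiff f X z
  InPgen⇒InSubdiff = InPgen⇒excess≤

  -- At an extreme point (x , e) of P_gen the constraint of a maximiser X of
  -- excess x is tight: (x , e) is the midpoint of (x , M) and (x , 2e − M),
  -- M = excess x X, both in P_gen, so these coincide and e = M.
  extreme⇒tight : ∀ {n} {f : Subset n → Carrier} {x e X} → IsExtremePair (InPgen f) x e →
                  (∀ Y → excess f x Y ≤ excess f x X) → e ≡ excess f x X
  extreme⇒tight {f = f} {x} {e} {X} (x∈P , extreme) X-max = antisym e≤M M≤e
    where
    M : Carrier
    M = excess f x X
    M≤e : M ≤ e
    M≤e = InPgen⇒excess≤ x∈P X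
    e≤2e-M : e ≤ e + (e - M)
    e≤2e-M = ≤-resp-≡ (+-identityʳ e) refl (+-monoʳ-≤ e (≤⇒0≤- M≤e))
    M≡2e-M : M ≡ e + (e - M)
    M≡2e-M = proj₂ (extreme x M x (e + (e - M)) ½ 0<½ ½<1
      (InSubdiff⇒InPgen X-max)
      (excess≤⇒InPgen (λ Y → ≤-trans (InPgen⇒excess≤ x∈P Y) e≤2e-M))
      (λ i → sym (cc-const ½ (x i))) (sym (cc-midpoint M e)))
    e≤M : e ≤ M
    e≤M = subst (e ≤_) (sym M≡2e-M) e≤2e-M

  -- If a point of P_gen that is tight at X splits properly inside P_gen,
  -- both parts are tight at X: their slacks are nonnegative and have a zero
  -- convex combination.
  split-tight : ∀ {n} {f : Subset n → Carrier} {x y w : Fin n → Carrier} {e d d' t X} →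
                0# < t → t < 1# → InPgen f y d → InPgen f w d' →
                (∀ i → x i ≡ cc t (y i) (w i)) → e ≡ cc t d d' → e ≡ excess f x X →
                d ≡ excess f y X × d' ≡ excess f w X
  split-tight {f = f} {x} {y} {w} {e} {d} {d'} {t} {X} 0<t t<1 y∈P w∈P x≡cc e≡cc e≡tight =
    -≡0⇒≡ (proj₁ slacks≡0) , -≡0⇒≡ (proj₂ slacks≡0)
    where
    slacks-cc≡0 : cc t (d - excess f y X) (d' - excess f w X) ≡ 0#
    slacks-cc≡0 = begin
      cc t (d - excess f y X) (d' - excess f w X)  ≡⟨ sym (cc-- t d d' (excess f y X) (excess f w X)) ⟩
      cc t d d' - cc t (excess f y X) (excess f w X) ≡⟨ cong₂ _-_ (sym e≡cc) (sym (excess-cc {f = f} x≡cc X)) ⟩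
      e - excess f x X                             ≡⟨ cong (_- excess f x X) e≡tight ⟩
      excess f x X - excess f x X                  ≡⟨ -‿inverseʳ (excess f x X) ⟩
      0#                                           ∎
    slacks≡0 : d - excess f y X ≡ 0# × d' - excess f w X ≡ 0#
    slacks≡0 = cc-nonneg-0 0<t t<1 (≤⇒0≤- (InPgen⇒excess≤ y∈P X)) (≤⇒0≤- (InPgen⇒excess≤ w∈P X))
                           slacks-cc≡0

  -- (⇒): take X maximising  excess x.  Then e = excess x X, x ∈ ∂^f(X), and a
  -- splitting of x inside ∂^f(X) lifts to a splitting of (x , e) in P_gen.
  extreme⇒subdiff-extreme : ∀ {n} {f : Subset n → Carrier} {x e} → IsExtremePair (InPgen f) x e →
                            Σ (Subset n) (λ X → IsExtreme (InSubdiff f X) x × e ≡ excess f x X)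
  extreme⇒subdiff-extreme {f = f} {x} {e} x-extreme@(_ , extreme) = X , (X-max , x-vertex) , e≡tight
    where
    X : Subset _
    X = proj₁ (maximiser (excess f x))
    X-max : InSubdiff f X x
    X-max = proj₂ (maximiser (excess f x))
    e≡tight : e ≡ excess f x X
    e≡tight = extreme⇒tight x-extreme X-max
    x-vertex : ∀ y w t → 0# < t → t < 1# → InSubdiff f X y → InSubdiff f X w →
               (∀ i → x i ≡ cc t (y i) (w i)) → ∀ i → y i ≡ w i
    x-vertex y w t 0<t t<1 y∈∂ w∈∂ x≡cc =
      proj₁ (extreme y (excess f y X) w (excess f w X) t 0<t t<1
                     (InSubdiff⇒InPgen y∈∂) (InSubdiff⇒InPgen w∈∂) x≡cc
                     (trans e≡tight (excess-cc {f = f} x≡cc X)))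

  -- (⇐): (x , e) is tight at X, so any splitting of it in P_gen consists of
  -- points tight at X, i.e. of points of ∂^f(X); these coincide since x is
  -- extreme there, and then so do their last coordinates.
  subdiff-extreme⇒extreme : ∀ {n} {f : Subset n → Carrier} {x e} →
                            Σ (Subset n) (λ X → IsExtreme (InSubdiff f X) x × e ≡ excess f x X) →
                            IsExtremePair (InPgen f) x e
  subdiff-extreme⇒extreme {f = f} {x} {e} (X , (x∈∂ , x-vertex) , e≡tight) = x∈P , extreme
    where
    x∈P : InPgen f x e
    x∈P = subst (InPgen f x) (sym e≡tight) (InSubdiff⇒InPgen x∈∂)
    extreme : ∀ y d w d' t → 0# < t → t < 1# → InPgen f y d → InPgen f w d' →
              (∀ i → x i ≡ cc t (y i) (w i)) → e ≡ cc t d d' → (∀ i → y i ≡ w i) × d ≡ d'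
    extreme y d w d' t 0<t t<1 y∈P w∈P x≡cc e≡cc = y≗w , d≡d'
      where
      tight : d ≡ excess f y X × d' ≡ excess f w X
      tight = split-tight {f = f} 0<t t<1 y∈P w∈P x≡cc e≡cc e≡tight
      y≗w : ∀ i → y i ≡ w i
      y≗w = x-vertex y w t 0<t t<1 (InPgen⇒InSubdiff (subst (InPgen f y) (proj₁ tight) y∈P))
                                    (InPgen⇒InSubdiff (subst (InPgen f w) (proj₂ tight) w∈P)) x≡cc
      d≡d' : d ≡ d'
      d≡d' = trans (proj₁ tight) (trans (cong (λ s → f X - s) (sumSet-cong y≗w X)) (sym (proj₂ tight)))

mainTheorem12 : ∀ {c ℓ} (F : OrderedField c ℓ) → let open OrderedField F in let open Submod F in
    (n : ℕ) (f : Subset n → Carrier) → Submodular f → f ∅ ≡ 0# →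
    (x : Fin n → Carrier) (e : Carrier) →
    IsExtremePair (InPgen f) x e ⇔
      Σ (Subset n) (λ X → IsExtreme (InSubdiff f X) x × e ≡ f X - sumSet x X)
mainTheorem12 F n f _ _ x e =
  mk⇔ (Excess.extreme⇒subdiff-extreme F) (Excess.subdiff-extreme⇒extreme F)
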